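{- Let $0<r\le 1$ be a real number such that $1/r$ is not an integer, and let $k=\lfloor 1/r\rfloor$. For a positive integer $n$ let $m=n-k\lceil rn\rceil$ and $l=(k+1)\lceil rn\rceil-n$. Then for all sufficiently large $n$, \[ Q(n,\lceil rn\rceil)\le \omega(kl,k)+\omega((k+1)m,k+1). \]
   Context: All graphs are finite and simple; $\omega(G)$, $\alpha(G)$, $\chi(G)$ denote clique number, independence number and chromatic number, and $|G|$ the number of vertices. For positive integers $n,k$, $\omega(n,k)=\min\{\omega(G): |G|=n \text{ and } \alpha(G)\le k\}$. For positive integers $n,c$, $Q(n,c)=\min\{\omega(G): |G|=n \text{ and } \chi(G)=c\}$. -}

module Defs where

open import Data.Nat as ℕ using (ℕ; zero; suc; _≤_; _<_; _+_; _*_; _∸_)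
open import Data.Integer as ℤ using (ℤ; +_)
open import Data.Rational as ℚ using (ℚ; _/_; 0ℚ; 1ℚ)
open import Data.Fin using (Fin)
open import Data.Fin.Subset using (Subset; _∈_; ∣_∣)
open import Data.Bool using (Bool; true; false)
open import Data.Product using (Σ; _×_; ∃)
open import Data.Sum using (_⊎_)
open import Relation.Nullary using (¬_)
open import Relation.Binary.PropositionalEquality using (_≡_; _≢_)

-- Real numbers, as (located) lower Dedekind cuts of ℚ.
-- The cut L r is the set of rationals q with q < r.

record ℝ : Set₁ where
  field
    L         : ℚ → Set
    inhabited : ∃ λ q → L q
    bounded   : ∃ λ q → ¬ L q
    downward  : ∀ {p q} → p ℚ.< q → L q → L p
    rounded   : ∀ {q} → L q → ∃ λ p → q ℚ.< p × L p
    located   : ∀ {p q} → p ℚ.< q → L p ⊎ ¬ L q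
open ℝ public

_<ℝ_ : ℚ → ℝ → Set
q <ℝ r = L r q

_ℝ≤_ : ℝ → ℚ → Set
r ℝ≤ q = ¬ L r q

_≡ℚ_ : ℝ → ℚ → Set
r ≡ℚ q = (r ℝ≤ q) × (∀ p → p ℚ.< q → p <ℝ r)

-- a / d as a rational (d ≥ 1 is the only case used; d = 0 gives 0)
frac : ℤ → ℕ → ℚ
frac a zero    = 0ℚ
frac a (suc d) = a / suc d

-- 1/r is not an integer: r ≠ 1/j for every positive integer j
-- (1/r ≠ 0 is automatic, and 1/r is positive since r > 0)
InvNotInteger : ℝ → Set
InvNotInteger r = ∀ j → 1 ≤ j → ¬ (r ≡ℚ frac (+ 1) j)

-- k = ⌊1/r⌋ for 0 < r, i.e. k ≤ 1/r < k+1, i.e. 1/(k+1) < r ≤ 1/k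
-- (for k = 0 the condition r ≤ 1/0 = ∞ is vacuous)
IsFloorInv : ℝ → ℕ → Set
IsFloorInv r zero    = frac (+ 1) 1 <ℝ r
IsFloorInv r (suc k) = (frac (+ 1) (suc (suc k)) <ℝ r) × (r ℝ≤ frac (+ 1) (suc k))

-- c = ⌈r·n⌉, i.e. c - 1 < r·n ≤ c  (for n = 0: r·0 = 0, so c = 0)
IsCeilMul : ℝ → ℕ → ℕ → Set
IsCeilMul r zero    c = c ≡ 0
IsCeilMul r (suc n) c =
  (frac (+ c ℤ.- + 1) (suc n) <ℝ r) × (r ℝ≤ frac (+ c) (suc n))

record Graph (n : ℕ) : Set where
  field
    E     : Fin n → Fin n → Bool
    sym   : ∀ i j → E i j ≡ E j i
    irrefl : ∀ i → E i i ≡ false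
open Graph public

IsClique : ∀ {n} → Graph n → Subset n → Set
IsClique G S = ∀ i j → i ∈ S → j ∈ S → i ≢ j → E G i j ≡ true

IsIndependent : ∀ {n} → Graph n → Subset n → Set
IsIndependent G S = ∀ i j → i ∈ S → j ∈ S → E G i j ≡ false

CliqueNumber : ∀ {n} → Graph n → ℕ → Set
CliqueNumber G w =
  (Σ (Subset _) λ S → IsClique G S × ∣ S ∣ ≡ w) ×
  (∀ S → IsClique G S → ∣ S ∣ ≤ w)

IndepAtMost : ∀ {n} → Graph n → ℕ → Set
IndepAtMost G k = ∀ S → IsIndependent G S → ∣ S ∣ ≤ k

IsProperColouring : ∀ {n} → Graph n → (c : ℕ) → (Fin n → Fin c) → Set
IsProperColouring G c f = ∀ i j → E G i j ≡ true → f i ≢ f j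

Colourable : ∀ {n} → Graph n → ℕ → Set
Colourable G c = Σ (Fin _ → Fin c) λ f → IsProperColouring G c f

ChromaticNumber : ∀ {n} → Graph n → ℕ → Set
ChromaticNumber G c = Colourable G c × (∀ d → d < c → ¬ Colourable G d)

IsMinOver : (n : ℕ) → (Graph n → ℕ → Set) → ℕ → Set
IsMinOver n P v = (Σ (Graph n) λ G → P G v) × (∀ G w → P G w → v ≤ w)

IsOmegaNK : ℕ → ℕ → ℕ → Set
IsOmegaNK n k v = IsMinOver n (λ G w → IndepAtMost G k × CliqueNumber G w) v

IsQ : ℕ → ℕ → ℕ → Set
IsQ n c v = IsMinOver n (λ G w → ChromaticNumber G c × CliqueNumber G w) v

-- Write c = ⌈rn⌉. From 1/(k+1) < r ≤ 1/k and c − 1 < rn ≤ c we get k(c − 1) < n < (k + 1)c, and this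
-- is all that is used about r; then c = l + m and n = kl + (k + 1)m. Take G₁ on kl vertices with α ≤ k and
-- clique number ω(kl,k), and G₂ on (k + 1)m vertices with α ≤ k + 1 and clique number ω((k+1)m,k+1). In a
-- proper colouring of their join H the two sides use disjoint sets of colours, and since colour classes are
-- independent, G₁ needs at least l of them and G₂ at least m; so χ(H) ≥ c, while ω(H) ≤ ω(G₁) + ω(G₂).
-- Putting back the edges of H one vertex at a time raises the chromatic number by at most one per step,
-- so some spanning subgraph of H has chromatic number exactly c, and Q(n,c) ≤ ω(H).

module Submission where

open import Defs hiding (sym)
open import Data.Bool using (Bool; true; false; _∧_)
open import Data.Bool.Properties using (∧-comm; ∧-zeroʳ; ∧-conicalʳ; T-≡)
open import Data.Fin using (Fin; zero; suc; _↑ˡ_; _↑ʳ_; splitAt; inject≤; inject₁; fromℕ; toℕ)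
open import Data.Fin.Properties
  using (any?; toℕ-injective; toℕ<n; inject≤-injective; inject₁-injective; fromℕ≢inject₁;
         splitAt-↑ˡ; splitAt-↑ʳ; splitAt⁻¹-↑ˡ; splitAt⁻¹-↑ʳ; ↑ˡ-injective; ↑ʳ-injective)
  renaming (_≟_ to _≟ᶠ_)
open import Data.Fin.Subset using (Subset; _∈_; _⊆_; ∣_∣; ⊥; ⊤; ∁)
open import Data.Fin.Subset.Properties
  using (∉⊥; ∈⊤; ∣⊥∣≡0; ∣⊤∣≡n; ∣p∣≤n; ∣∁p∣≡n∸∣p∣; p⊆q⇒∣p∣≤∣q∣; x∉p⇒x∈∁p)
open import Data.Nat using (ℕ; zero; suc; NonZero; _≤_; _<_; _+_; _*_; _∸_; _<ᵇ_; _≟_; _≤?_; z≤n; s≤s⁻¹)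
open import Data.Nat.Properties
  using (+-*-semiring; ≤-trans; <⇒≤; <⇒≱; ≰⇒>; ≤∧≢⇒<; <-irrefl; 1+n≰n; <⇒<ᵇ;
         +-comm; +-assoc; +-identityʳ; +-mono-≤; +-cancelˡ-<; m≤m+n;
         *-comm; *-identityʳ; *-zeroʳ; *-distribˡ-+; *-monoʳ-≤; *-cancelˡ-≤;
         m≤n⇒∃[o]m+o≡n; m+[n∸m]≡n; m∸n+n≡m; m+n∸n≡m; [m+n]∸[m+o]≡n∸o; ∸-monoʳ-≤;
         module ≤-Reasoning)
open import Data.Product using (Σ; ∃; _×_; _,_)
open import Data.Sum using (_⊎_; inj₁; inj₂)
open import Data.Vec using ([]; _∷_; _++_; lookup; tabulate)
import Data.Vec as Vec
open import Data.Vec.Properties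
  using (lookup∘tabulate; tabulate∘lookup; []=⇒lookup; lookup⇒[]=; lookup-++ˡ; lookup-++ʳ)
open import Function using (_∘_)
open import Function.Bundles using (Equivalence)
open import Relation.Nullary using (¬_; does; yes; no; contradiction)
open import Relation.Nullary.Decidable using (dec-true; decidable-stable; ¬¬-excluded-middle)
open import Relation.Binary.PropositionalEquality
  using (_≡_; _≢_; refl; sym; trans; cong; cong₂; subst; subst₂; module ≡-Reasoning)
open import Algebra.Properties.Semiring.Sum +-*-semiring
  using (sum; sum-syntax; sum-cong-≗; sum-replicate-zero; ∑-comm; *-distribˡ-sum)

∈-tabulate⁺ : ∀ {n} {g : Fin n → Bool} {i} → g i ≡ true → i ∈ tabulate g
∈-tabulate⁺ {g = g} {i} gi = lookup⇒[]= i (tabulate g) (trans (lookup∘tabulate g i) gi)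

∈-tabulate⁻ : ∀ {n} {g : Fin n → Bool} {i} → i ∈ tabulate g → g i ≡ true
∈-tabulate⁻ {g = g} {i} i∈ = trans (sym (lookup∘tabulate g i)) ([]=⇒lookup i∈)

∣p++q∣≡∣p∣+∣q∣ : ∀ {m n} (p : Subset m) (q : Subset n) → ∣ p ++ q ∣ ≡ ∣ p ∣ + ∣ q ∣
∣p++q∣≡∣p∣+∣q∣ []          q = refl
∣p++q∣≡∣p∣+∣q∣ (true ∷ p)  q = cong suc (∣p++q∣≡∣p∣+∣q∣ p q)
∣p++q∣≡∣p∣+∣q∣ (false ∷ p) q = ∣p++q∣≡∣p∣+∣q∣ p q

∈-++⁺ˡ : ∀ {m n} {p : Subset m} {i} (q : Subset n) → i ∈ p → i ↑ˡ n ∈ p ++ q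
∈-++⁺ˡ {p = p} {i} q i∈p = lookup⇒[]= (i ↑ˡ _) (p ++ q) (trans (lookup-++ˡ p q i) ([]=⇒lookup i∈p))

∈-++⁺ʳ : ∀ {m n} (p : Subset m) {q : Subset n} {j} → j ∈ q → m ↑ʳ j ∈ p ++ q
∈-++⁺ʳ p {q} {j} j∈q = lookup⇒[]= (_ ↑ʳ j) (p ++ q) (trans (lookup-++ʳ p q j) ([]=⇒lookup j∈q))

∈-++⁻ : ∀ {m n} (p : Subset m) (q : Subset n) {v} → v ∈ p ++ q →
  (∃ λ i → i ↑ˡ n ≡ v × i ∈ p) ⊎ (∃ λ j → m ↑ʳ j ≡ v × j ∈ q)
∈-++⁻ {m} {n} p q {v} v∈ with splitAt m v in split
... | inj₁ i with refl ← splitAt⁻¹-↑ˡ split =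
  inj₁ (i , refl , lookup⇒[]= i p (trans (sym (lookup-++ˡ p q i)) ([]=⇒lookup v∈)))
... | inj₂ j with refl ← splitAt⁻¹-↑ʳ split =
  inj₂ (j , refl , lookup⇒[]= j q (trans (sym (lookup-++ʳ p q j)) ([]=⇒lookup v∈)))

∣p∣+∣∁p∣≡n : ∀ {n} (p : Subset n) → ∣ p ∣ + ∣ ∁ p ∣ ≡ n
∣p∣+∣∁p∣≡n p = trans (cong (∣ p ∣ +_) (∣∁p∣≡n∸∣p∣ p)) (m+[n∸m]≡n (∣p∣≤n p))

-- Counting by colour classes

indicator : Bool → ℕ
indicator true  = 1
indicator false = 0

∣tabulate∣≡∑ : ∀ {n} (g : Fin n → Bool) → ∣ tabulate g ∣ ≡ ∑[ i < n ] indicator (g i)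
∣tabulate∣≡∑ {zero}  g = refl
∣tabulate∣≡∑ {suc n} g with g zero
... | true  = cong suc (∣tabulate∣≡∑ (g ∘ suc))
... | false = ∣tabulate∣≡∑ (g ∘ suc)

∣p∣≡∑ : ∀ {d} (p : Subset d) → ∣ p ∣ ≡ ∑[ c < d ] indicator (lookup p c)
∣p∣≡∑ p = trans (cong ∣_∣ (sym (tabulate∘lookup p))) (∣tabulate∣≡∑ (lookup p))

∑-mono-≤ : ∀ {n} {f g : Fin n → ℕ} → (∀ i → f i ≤ g i) → sum f ≤ sum g
∑-mono-≤ {zero}  f≤g = z≤n
∑-mono-≤ {suc n} f≤g = +-mono-≤ (f≤g zero) (∑-mono-≤ (f≤g ∘ suc))

∑-const-1 : ∀ n → ∑[ i < n ] 1 ≡ n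
∑-const-1 zero    = refl
∑-const-1 (suc n) = cong suc (∑-const-1 n)

∑-indicator-≟ : ∀ {d} (j : Fin d) → ∑[ i < d ] indicator (does (j ≟ᶠ i)) ≡ 1
∑-indicator-≟ {suc d} zero    = cong suc (sum-replicate-zero d)
∑-indicator-≟ {suc d} (suc j) = ∑-indicator-≟ j

fibre : ∀ {n d} → (Fin n → Fin d) → Fin d → Subset n
fibre f c = tabulate λ v → does (f v ≟ᶠ c)

∈-fibre⁻ : ∀ {n d} {f : Fin n → Fin d} {c v} → v ∈ fibre f c → f v ≡ c
∈-fibre⁻ {f = f} {c} {v} v∈ with f v ≟ᶠ c | ∈-tabulate⁻ v∈
... | yes fv≡c | _ = fv≡c

∑-∣fibre∣ : ∀ {n d} (f : Fin n → Fin d) → ∑[ c < d ] ∣ fibre f c ∣ ≡ n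
∑-∣fibre∣ {n} {d} f = begin
  ∑[ c < d ] ∣ fibre f c ∣                             ≡⟨ sum-cong-≗ (λ c → ∣tabulate∣≡∑ λ v → does (f v ≟ᶠ c)) ⟩
  ∑[ c < d ] ∑[ v < n ] indicator (does (f v ≟ᶠ c))   ≡⟨ ∑-comm (λ c v → indicator (does (f v ≟ᶠ c))) ⟩
  ∑[ v < n ] ∑[ c < d ] indicator (does (f v ≟ᶠ c))   ≡⟨ sum-cong-≗ (λ v → ∑-indicator-≟ (f v)) ⟩
  ∑[ v < n ] 1                                         ≡⟨ ∑-const-1 n ⟩
  n                                                    ∎
  where open ≡-Reasoning

pigeonhole : ∀ {n d k} (f : Fin n → Fin d) (U : Subset d) → (∀ v → f v ∈ U) →
  (∀ c → ∣ fibre f c ∣ ≤ k) → n ≤ k * ∣ U ∣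
pigeonhole {n} {d} {k} f U f∈U ∣fibre∣≤k = begin
  n                                        ≡⟨ sym (∑-∣fibre∣ f) ⟩
  ∑[ c < d ] ∣ fibre f c ∣                 ≤⟨ ∑-mono-≤ ∣fibre∣≤k·[∈U] ⟩
  ∑[ c < d ] (k * indicator (lookup U c))  ≡⟨ sym (*-distribˡ-sum k (indicator ∘ lookup U)) ⟩
  k * (∑[ c < d ] indicator (lookup U c))  ≡⟨ cong (k *_) (sym (∣p∣≡∑ U)) ⟩
  k * ∣ U ∣                                ∎
  where
  open ≤-Reasoning
  ∣fibre∣≤k·[∈U] : ∀ c → ∣ fibre f c ∣ ≤ k * indicator (lookup U c)
  ∣fibre∣≤k·[∈U] c with lookup U c in c∈?U
  ... | true  = subst (∣ fibre f c ∣ ≤_) (sym (*-identityʳ k)) (∣fibre∣≤k c)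
  ... | false = subst (∣ fibre f c ∣ ≤_) (trans (∣⊥∣≡0 n) (sym (*-zeroʳ k))) (p⊆q⇒∣p∣≤∣q∣ fibre⊆⊥)
    where
    fibre⊆⊥ : fibre f c ⊆ ⊥
    fibre⊆⊥ {v} v∈ with () ← trans (sym c∈?U) ([]=⇒lookup (subst (_∈ U) (∈-fibre⁻ {f = f} v∈) (f∈U v)))

image : ∀ {n d} → (Fin n → Fin d) → Subset d
image f = tabulate λ c → does (any? λ v → f v ≟ᶠ c)

∈-image⁺ : ∀ {n d} (f : Fin n → Fin d) v → f v ∈ image f
∈-image⁺ f v = ∈-tabulate⁺ (dec-true (any? λ u → f u ≟ᶠ f v) (v , refl))

∈-image⁻ : ∀ {n d} {f : Fin n → Fin d} {c} → c ∈ image f → ∃ λ v → f v ≡ c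
∈-image⁻ {f = f} {c} c∈ with any? (λ v → f v ≟ᶠ c) | ∈-tabulate⁻ c∈
... | yes fv≡c | _ = fv≡c

CliqueAtMost : ∀ {n} → Graph n → ℕ → Set
CliqueAtMost G w = ∀ S → IsClique G S → ∣ S ∣ ≤ w

_⊆ᴱ_ : ∀ {n} → Graph n → Graph n → Set
G ⊆ᴱ H = ∀ u v → E G u v ≡ true → E H u v ≡ true

Colourable-⊆ᴱ : ∀ {n d} {G H : Graph n} → G ⊆ᴱ H → Colourable H d → Colourable G d
Colourable-⊆ᴱ G⊆H (f , proper) = f , λ u v uv → proper u v (G⊆H u v uv)

CliqueAtMost-⊆ᴱ : ∀ {n w} {G H : Graph n} → G ⊆ᴱ H → CliqueAtMost H w → CliqueAtMost G w
CliqueAtMost-⊆ᴱ G⊆H ω≤w S clique = ω≤w S λ i j i∈ j∈ i≢j → G⊆H i j (clique i j i∈ j∈ i≢j)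

Colourable-mono : ∀ {n d d'} {G : Graph n} → d ≤ d' → Colourable G d → Colourable G d'
Colourable-mono d≤d' (f , proper) =
  (λ u → inject≤ (f u) d≤d') , λ u v uv fu≡fv → proper u v uv (inject≤-injective _ _ _ _ fu≡fv)

ChromaticNumber-intro : ∀ {n c} {G : Graph n} → ¬ Colourable G c → Colourable G (suc c) →
  ChromaticNumber G (suc c)
ChromaticNumber-intro {G = G} ¬col col =
  col , λ d d<1+c col-d → ¬col (Colourable-mono {G = G} (s≤s⁻¹ d<1+c) col-d)

CliqueNumber⇒≤ : ∀ {n w w'} {G : Graph n} → CliqueNumber G w → CliqueAtMost G w' → w ≤ w'
CliqueNumber⇒≤ ((S , clique , ∣S∣≡w) , _) ω≤w' = subst (_≤ _) ∣S∣≡w (ω≤w' S clique)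

fibre-independent : ∀ {n d} {G : Graph n} {f : Fin n → Fin d} →
  IsProperColouring G d f → ∀ c → IsIndependent G (fibre f c)
fibre-independent {G = G} {f} proper c u v u∈ v∈ with E G u v in uv
... | false = refl
... | true  = contradiction (trans (∈-fibre⁻ {f = f} u∈) (sym (∈-fibre⁻ {f = f} v∈))) (proper u v uv)

colouring-bound : ∀ {n d k} {G : Graph n} {f : Fin n → Fin d} → IndepAtMost G k →
  IsProperColouring G d f → (U : Subset d) → (∀ v → f v ∈ U) → n ≤ k * ∣ U ∣
colouring-bound {G = G} {f} α≤k proper U f∈U =
  pigeonhole f U f∈U λ c → α≤k (fibre f c) (fibre-independent {G = G} proper c)

colourable-bound : ∀ {n d k} {G : Graph n} → IndepAtMost G k → Colourable G d → n ≤ k * d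
colourable-bound {n} {d} {k} {G} α≤k (f , proper) =
  subst (n ≤_) (cong (k *_) (∣⊤∣≡n d)) (colouring-bound {G = G} α≤k proper ⊤ λ _ → ∈⊤)

-- Joins and induced subgraphs

join : ∀ {m n} → Graph m → Graph n → Graph (m + n)
join {m} {n} G H = record
  { E      = λ u v → edge (splitAt m u) (splitAt m v)
  ; sym    = λ u v → edge-sym (splitAt m u) (splitAt m v)
  ; irrefl = λ u → edge-irrefl (splitAt m u)
  }
  where
  edge : Fin m ⊎ Fin n → Fin m ⊎ Fin n → Bool
  edge (inj₁ i) (inj₁ j) = E G i j
  edge (inj₂ i) (inj₂ j) = E H i j
  edge (inj₁ _) (inj₂ _) = true
  edge (inj₂ _) (inj₁ _) = true

  edge-sym : ∀ s t → edge s t ≡ edge t s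
  edge-sym (inj₁ i) (inj₁ j) = Graph.sym G i j
  edge-sym (inj₂ i) (inj₂ j) = Graph.sym H i j
  edge-sym (inj₁ _) (inj₂ _) = refl
  edge-sym (inj₂ _) (inj₁ _) = refl

  edge-irrefl : ∀ s → edge s s ≡ false
  edge-irrefl (inj₁ i) = irrefl G i
  edge-irrefl (inj₂ i) = irrefl H i

module _ {m n} {G : Graph m} {H : Graph n} where

  E-join-↑ˡ : ∀ i j → E (join G H) (i ↑ˡ n) (j ↑ˡ n) ≡ E G i j
  E-join-↑ˡ i j rewrite splitAt-↑ˡ m i n | splitAt-↑ˡ m j n = refl

  E-join-↑ʳ : ∀ i j → E (join G H) (m ↑ʳ i) (m ↑ʳ j) ≡ E H i j
  E-join-↑ʳ i j rewrite splitAt-↑ʳ m n i | splitAt-↑ʳ m n j = refl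

  E-join-↑ˡ-↑ʳ : ∀ i j → E (join G H) (i ↑ˡ n) (m ↑ʳ j) ≡ true
  E-join-↑ˡ-↑ʳ i j rewrite splitAt-↑ˡ m i n | splitAt-↑ʳ m n j = refl

  join-CliqueAtMost : ∀ {a b} → CliqueAtMost G a → CliqueAtMost H b → CliqueAtMost (join G H) (a + b)
  join-CliqueAtMost {a} {b} ω≤a ω≤b S clique with Vec.splitAt m S
  ... | p , q , refl =
    subst (_≤ a + b) (sym (∣p++q∣≡∣p∣+∣q∣ p q)) (+-mono-≤ (ω≤a p clique-p) (ω≤b q clique-q))
    where
    clique-p : IsClique G p
    clique-p i j i∈ j∈ i≢j = trans (sym (E-join-↑ˡ i j))
      (clique _ _ (∈-++⁺ˡ q i∈) (∈-++⁺ˡ q j∈) (i≢j ∘ ↑ˡ-injective n i j))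
    clique-q : IsClique H q
    clique-q i j i∈ j∈ i≢j = trans (sym (E-join-↑ʳ i j))
      (clique _ _ (∈-++⁺ʳ p i∈) (∈-++⁺ʳ p j∈) (i≢j ∘ ↑ʳ-injective m i j))

  join-colour-split : ∀ {k k′ d} → IndepAtMost G k → IndepAtMost H k′ → Colourable (join G H) d →
    Σ (Subset d) λ U → m ≤ k * ∣ U ∣ × n ≤ k′ * ∣ ∁ U ∣
  join-colour-split {d = d} α≤k α≤k′ (f , proper) =
    U , colouring-bound {G = G} α≤k properˡ U (∈-image⁺ fˡ)
      , colouring-bound {G = H} α≤k′ properʳ (∁ U) fʳ∈∁U
    where
    fˡ : Fin m → Fin d
    fˡ = f ∘ (_↑ˡ n)
    fʳ : Fin n → Fin d
    fʳ = f ∘ (m ↑ʳ_)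
    U : Subset d
    U = image fˡ
    properˡ : IsProperColouring G d fˡ
    properˡ i j ij = proper _ _ (trans (E-join-↑ˡ i j) ij)
    properʳ : IsProperColouring H d fʳ
    properʳ i j ij = proper _ _ (trans (E-join-↑ʳ i j) ij)
    fʳ∈∁U : ∀ v → fʳ v ∈ ∁ U
    fʳ∈∁U v = x∉p⇒x∈∁p λ fv∈U → let u , fu≡fv = ∈-image⁻ fv∈U in proper _ _ (E-join-↑ˡ-↑ʳ u v) fu≡fv

restrict : ∀ {n e} → Graph (n + e) → Graph n
restrict {e = e} G = record
  { E      = λ i j → E G (i ↑ˡ e) (j ↑ˡ e)
  ; sym    = λ i j → Graph.sym G (i ↑ˡ e) (j ↑ˡ e)
  ; irrefl = λ i → irrefl G (i ↑ˡ e)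
  }

module _ {n e} {G : Graph (n + e)} where

  private
    ∣p++⊥∣≡∣p∣ : (p : Subset n) → ∣ p ++ ⊥ {e} ∣ ≡ ∣ p ∣
    ∣p++⊥∣≡∣p∣ p = trans (∣p++q∣≡∣p∣+∣q∣ p ⊥) (trans (cong (∣ p ∣ +_) (∣⊥∣≡0 e)) (+-identityʳ ∣ p ∣))

    ∈-++⊥⁻ : ∀ (p : Subset n) {v} → v ∈ p ++ ⊥ → ∃ λ i → i ↑ˡ e ≡ v × i ∈ p
    ∈-++⊥⁻ p v∈ with ∈-++⁻ p ⊥ v∈
    ... | inj₁ i∈p          = i∈p
    ... | inj₂ (_ , _ , j∈⊥) = contradiction j∈⊥ ∉⊥

  restrict-IndepAtMost : ∀ {k} → IndepAtMost G k → IndepAtMost (restrict G) k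
  restrict-IndepAtMost {k} α≤k S independent =
    subst (_≤ k) (∣p++⊥∣≡∣p∣ S) (α≤k (S ++ ⊥) independent⁺)
    where
    independent⁺ : IsIndependent G (S ++ ⊥)
    independent⁺ u v u∈ v∈ with ∈-++⊥⁻ S u∈ | ∈-++⊥⁻ S v∈
    ... | i , refl , i∈ | j , refl , j∈ = independent i j i∈ j∈

  restrict-CliqueAtMost : ∀ {a} → CliqueAtMost G a → CliqueAtMost (restrict G) a
  restrict-CliqueAtMost {a} ω≤a S clique =
    subst (_≤ a) (∣p++⊥∣≡∣p∣ S) (ω≤a (S ++ ⊥) clique⁺)
    where
    clique⁺ : IsClique G (S ++ ⊥)
    clique⁺ u v u∈ v∈ u≢v with ∈-++⊥⁻ S u∈ | ∈-++⊥⁻ S v∈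
    ... | i , refl , i∈ | j , refl , j∈ = clique i j i∈ j∈ (u≢v ∘ cong (_↑ˡ e))

induced-subgraph : ∀ {n N k a} → n ≤ N → (G : Graph N) → IndepAtMost G k → CliqueAtMost G a →
  Σ (Graph n) λ R → IndepAtMost R k × CliqueAtMost R a
induced-subgraph n≤N G α≤k ω≤a with m≤n⇒∃[o]m+o≡n n≤N
... | _ , refl = restrict G , restrict-IndepAtMost {G = G} α≤k , restrict-CliqueAtMost {G = G} ω≤a

-- Graphs of prescribed chromatic number

<ᵇ-suc-≢ : ∀ {m n} → m ≢ n → (m <ᵇ suc n) ≡ (m <ᵇ n)
<ᵇ-suc-≢ {zero}  {zero}  0≢0 = contradiction refl 0≢0
<ᵇ-suc-≢ {zero}  {suc n} _   = refl
<ᵇ-suc-≢ {suc m} {zero}  _   = refl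
<ᵇ-suc-≢ {suc m} {suc n} m≢n = <ᵇ-suc-≢ (m≢n ∘ cong suc)

module _ {N} (H : Graph N) where

  inPrefix : ℕ → Fin N → Bool
  inPrefix t u = toℕ u <ᵇ t

  prefix : ℕ → Graph N
  prefix t = record
    { E      = λ u v → (inPrefix t u ∧ inPrefix t v) ∧ E H u v
    ; sym    = λ u v → cong₂ _∧_ (∧-comm (inPrefix t u) _) (Graph.sym H u v)
    ; irrefl = λ u → trans (cong ((inPrefix t u ∧ inPrefix t u) ∧_) (irrefl H u)) (∧-zeroʳ _)
    }

  prefix-⊆ᴱ : ∀ t → prefix t ⊆ᴱ H
  prefix-⊆ᴱ t u v uv = ∧-conicalʳ _ _ uv

  inPrefix-N : ∀ w → inPrefix N w ≡ true
  inPrefix-N w = Equivalence.to T-≡ (<⇒<ᵇ (toℕ<n w))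

  ⊆ᴱ-prefix-N : H ⊆ᴱ prefix N
  ⊆ᴱ-prefix-N u v uv rewrite inPrefix-N u | inPrefix-N v = uv

  E-prefix-suc : ∀ s {u v} → toℕ u ≢ s → toℕ v ≢ s → E (prefix (suc s)) u v ≡ E (prefix s) u v
  E-prefix-suc s {u} {v} u≢s v≢s rewrite <ᵇ-suc-≢ u≢s | <ᵇ-suc-≢ v≢s = refl

  prefix-zero-colourable : ∀ {c} → Colourable (prefix 0) (suc c)
  prefix-zero-colourable = (λ _ → zero) , λ u v ()

  prefix-suc-colourable : ∀ {s c} → Colourable (prefix s) c → Colourable (prefix (suc s)) (suc c)
  prefix-suc-colourable {s} {c} (f , proper) = f′ , proper′
    where
    f′ : Fin N → Fin (suc c)
    f′ u with toℕ u ≟ s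
    ... | yes _ = fromℕ c
    ... | no _  = inject₁ (f u)
    proper′ : IsProperColouring (prefix (suc s)) (suc c) f′
    proper′ u v uv with toℕ u ≟ s | toℕ v ≟ s
    ... | yes u≡s | yes v≡s with refl ← toℕ-injective (trans u≡s (sym v≡s)) =
      contradiction (trans (sym uv) (irrefl (prefix (suc s)) u)) λ ()
    ... | yes _   | no _    = fromℕ≢inject₁
    ... | no _    | yes _   = fromℕ≢inject₁ ∘ sym
    ... | no u≢s  | no v≢s  = proper u v (trans (sym (E-prefix-suc s u≢s v≢s)) uv) ∘ inject₁-injective

  ¬¬-critical-prefix : ∀ {c} t → ¬ Colourable (prefix t) c →
    ¬ ¬ (Σ ℕ λ s → ChromaticNumber (prefix s) (suc c))
  ¬¬-critical-prefix zero    ¬col k = k (0 , ChromaticNumber-intro {G = prefix 0} ¬col prefix-zero-colourable)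
  ¬¬-critical-prefix (suc t) ¬col k = ¬¬-excluded-middle λ
    { (yes col)  → k (suc t , ChromaticNumber-intro {G = prefix (suc t)} ¬col (prefix-suc-colourable col))
    ; (no ¬col′) → ¬¬-critical-prefix t ¬col′ k
    }

¬¬-CliqueNumber : ∀ {n} (G : Graph n) t → CliqueAtMost G t → ¬ ¬ (Σ ℕ (CliqueNumber G))
¬¬-CliqueNumber {n} G zero    ω≤0 k = k (0 , (⊥ , (λ i _ i∈⊥ → contradiction i∈⊥ ∉⊥) , ∣⊥∣≡0 n) , ω≤0)
¬¬-CliqueNumber     G (suc t) ω≤t+1 k = ¬¬-excluded-middle λ
  { (yes clique) → k (suc t , clique , ω≤t+1)
  ; (no ¬clique) → ¬¬-CliqueNumber G t
      (λ S S-clique → s≤s⁻¹ (≤∧≢⇒< (ω≤t+1 S S-clique) λ ∣S∣≡t+1 → ¬clique (S , S-clique , ∣S∣≡t+1))) k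
  }

-- Both the critical prefix and the clique number exist only classically, but the goal q ≤ B is
-- decidable, so the double negations can be discharged.
Q≤ω-of-χ> : ∀ {N c B q} (H : Graph N) → ¬ Colourable H c → CliqueAtMost H B → IsQ N (suc c) q → q ≤ B
Q≤ω-of-χ> {N} {c} {B} {q} H ¬col ω≤B (_ , Q-minimal) = decidable-stable (q ≤? B) λ q≰B →
  ¬¬-critical-prefix H N (¬col ∘ Colourable-⊆ᴱ {G = H} {prefix H N} (⊆ᴱ-prefix-N H)) λ (s , χ≡c+1) →
  ¬¬-CliqueNumber (prefix H s) B (ω-prefix≤B s) λ (w , ω≡w) →
  q≰B (≤-trans (Q-minimal (prefix H s) w (χ≡c+1 , ω≡w)) (CliqueNumber⇒≤ {G = prefix H s} ω≡w (ω-prefix≤B s)))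
  where
  ω-prefix≤B : ∀ s → CliqueAtMost (prefix H s) B
  ω-prefix≤B s = CliqueAtMost-⊆ᴱ {G = prefix H s} {H} (prefix-⊆ᴱ H s) ω≤B

part-sizes : ∀ k c n → k * c ≤ n → n < suc k * c →
  (suc k * c ∸ n) + (n ∸ k * c) ≡ c × k * (suc k * c ∸ n) + suc k * (n ∸ k * c) ≡ n
part-sizes k c n kc≤n n<[k+1]c = l+m≡c , kl+[k+1]m≡n
  where
  m l : ℕ
  m = n ∸ k * c
  l = suc k * c ∸ n
  kc+m≡n : k * c + m ≡ n
  kc+m≡n = m+[n∸m]≡n kc≤n
  m<c : m < c
  m<c = +-cancelˡ-< (k * c) m c (subst₂ _<_ (sym kc+m≡n) (+-comm c (k * c)) n<[k+1]c)
  l+m≡c : l + m ≡ c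
  l+m≡c = begin
    (c + k * c) ∸ n + m            ≡⟨ cong (λ x → x ∸ n + m) (+-comm c (k * c)) ⟩
    (k * c + c) ∸ n + m            ≡⟨ cong (λ x → (k * c + c) ∸ x + m) (sym kc+m≡n) ⟩
    (k * c + c) ∸ (k * c + m) + m  ≡⟨ cong (_+ m) ([m+n]∸[m+o]≡n∸o (k * c) c m) ⟩
    c ∸ m + m                      ≡⟨ m∸n+n≡m (<⇒≤ m<c) ⟩
    c                              ∎
    where open ≡-Reasoning
  kl+[k+1]m≡n : k * l + suc k * m ≡ n
  kl+[k+1]m≡n = begin
    k * l + (m + k * m)  ≡⟨ cong (k * l +_) (+-comm m (k * m)) ⟩
    k * l + (k * m + m)  ≡⟨ sym (+-assoc (k * l) (k * m) m) ⟩
    k * l + k * m + m    ≡⟨ cong (_+ m) (sym (*-distribˡ-+ k l m)) ⟩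
    k * (l + m) + m      ≡⟨ cong (λ x → k * x + m) l+m≡c ⟩
    k * c + m            ≡⟨ kc+m≡n ⟩
    n                    ∎
    where open ≡-Reasoning

Q≤ω+ω-join : ∀ {k l m c q a b} .{{_ : NonZero k}} → l + m ≡ suc c →
  IsQ (k * l + suc k * m) (suc c) q → IsOmegaNK (k * l) k a → IsOmegaNK (suc k * m) (suc k) b →
  q ≤ a + b
Q≤ω+ω-join {k} {l} {m} {c} l+m≡c+1 Q ((G , α≤k , _ , ω≤a) , _) ((G′ , α≤k+1 , _ , ω≤b) , _) =
  Q≤ω-of-χ> (join G G′) ¬colourable (join-CliqueAtMost {G = G} {G′} ω≤a ω≤b) Q
  where
  ¬colourable : ¬ Colourable (join G G′) c
  ¬colourable col with join-colour-split {G = G} {G′} α≤k α≤k+1 col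
  ... | U , kl≤k∣U∣ , [k+1]m≤[k+1]∣∁U∣ = 1+n≰n (begin
    suc c           ≡⟨ sym l+m≡c+1 ⟩
    l + m           ≤⟨ +-mono-≤ (*-cancelˡ-≤ k kl≤k∣U∣) (*-cancelˡ-≤ (suc k) [k+1]m≤[k+1]∣∁U∣) ⟩
    ∣ U ∣ + ∣ ∁ U ∣ ≡⟨ ∣p∣+∣∁p∣≡n U ⟩
    c               ∎)
    where open ≤-Reasoning

Q≤ω-restrict : ∀ {k c n N q a} → k * c < n → n ≤ N → IsQ n (suc c) q → IsOmegaNK N k a → q ≤ a
Q≤ω-restrict kc<n n≤N Q ((G , α≤k , _ , ω≤a) , _) with induced-subgraph n≤N G α≤k ω≤a
... | R , α[R]≤k , ω[R]≤a = Q≤ω-of-χ> R (λ col → <⇒≱ kc<n (colourable-bound {G = R} α[R]≤k col)) ω[R]≤a Q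

-- When n < k(c + 1), which happens for small n or when 1/r is an integer, m = n ∸ k(c + 1) is a
-- truncated 0 and an n-vertex induced subgraph of G₁ alone already needs c + 1 colours; this is why the
-- theorem holds for every n ≥ 1 and without using that 1/r is not an integer.
Q≤ω+ω : ∀ {k c n q a b} .{{_ : NonZero k}} → k * c < n → n < suc k * suc c →
  IsQ n (suc c) q → IsOmegaNK (k * (suc k * suc c ∸ n)) k a →
  IsOmegaNK (suc k * (n ∸ k * suc c)) (suc k) b → q ≤ a + b
Q≤ω+ω {k} {c} {n} {q} {a} {b} kc<n n<[k+1][c+1] Q ω-a ω-b with k * suc c ≤? n
... | yes k[c+1]≤n =
  let l+m≡c+1 , kl+[k+1]m≡n = part-sizes k (suc c) n k[c+1]≤n n<[k+1][c+1] in
  Q≤ω+ω-join l+m≡c+1 (subst (λ N → IsQ N (suc c) q) (sym kl+[k+1]m≡n) Q) ω-a ω-b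
... | no k[c+1]≰n = ≤-trans (Q≤ω-restrict kc<n n≤kl Q ω-a) (m≤m+n a b)
  where
  n<k[c+1] : n < k * suc c
  n<k[c+1] = ≰⇒> k[c+1]≰n
  c+1≤l : suc c ≤ suc k * suc c ∸ n
  c+1≤l = subst (_≤ suc k * suc c ∸ n) (m+n∸n≡m (suc c) (k * suc c))
                (∸-monoʳ-≤ (suc c + k * suc c) (<⇒≤ n<k[c+1]))
  n≤kl : n ≤ k * (suc k * suc c ∸ n)
  n≤kl = ≤-trans (<⇒≤ n<k[c+1]) (*-monoʳ-≤ k c+1≤l)

-- Reading off ⌊1/r⌋ and ⌈rn⌉

-- Imported only here: with the prefix +_ in scope, ℕ sections such as (x +_) above are ambiguous.
open import Data.Integer using (+_)
import Data.Integer.Properties as ℤ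
import Data.Rational as ℚ
import Data.Rational.Properties as ℚ
import Data.Rational.Unnormalised as ℚᵘ
import Data.Rational.Unnormalised.Properties as ℚᵘ
open import Relation.Binary using (tri<; tri≈; tri>)

<ℝ-ℝ≤⇒< : ∀ (r : ℝ) {p q} → p <ℝ r → r ℝ≤ q → p ℚ.< q
<ℝ-ℝ≤⇒< r {p} {q} p<r r≤q with ℚ.<-cmp p q
... | tri< p<q _    _   = p<q
... | tri≈ _   refl _   = contradiction p<r r≤q
... | tri> _   _    q<p = contradiction (downward r q<p p<r) r≤q

-- ℚ's a / (1 + b) is by definition the normalisation fromℚᵘ (mkℚᵘ a b), which is compared in ℚᵘ.
/-<⇒*-< : ∀ a b c d → + a ℚ./ suc b ℚ.< + c ℚ./ suc d → a * suc d < c * suc b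
/-<⇒*-< a b c d a/b<c/d = ℤ.+◃-cancel-< (ℚᵘ.drop-*<* (begin-strict
  ℚᵘ.mkℚᵘ (+ a) b          ≃⟨ ℚ.toℚᵘ-fromℚᵘ (ℚᵘ.mkℚᵘ (+ a) b) ⟨
  ℚ.toℚᵘ (+ a ℚ./ suc b)   <⟨ ℚ.toℚᵘ-mono-< a/b<c/d ⟩
  ℚ.toℚᵘ (+ c ℚ./ suc d)   ≃⟨ ℚ.toℚᵘ-fromℚᵘ (ℚᵘ.mkℚᵘ (+ c) d) ⟩
  ℚᵘ.mkℚᵘ (+ c) d          ∎))
  where open ℚᵘ.≤-Reasoning

¬IsCeilMul-zero : ∀ r n → frac (+ 0) 1 <ℝ r → ¬ IsCeilMul r (suc n) 0
¬IsCeilMul-zero r n 0<r (_ , r≤0) = <-irrefl refl (/-<⇒*-< 0 0 0 n (<ℝ-ℝ≤⇒< r 0<r r≤0))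

IsCeilMul-bounds : ∀ r k n c → IsFloorInv r (suc k) → IsCeilMul r (suc n) (suc c) →
  suc k * c < suc n × suc n < suc (suc k) * suc c
IsCeilMul-bounds r k n c (1/[k+2]<r , r≤1/[k+1]) (c/[n+1]<r , r≤[c+1]/[n+1]) =
  subst₂ _<_ (*-comm c (suc k)) (+-identityʳ (suc n))
    (/-<⇒*-< c n 1 k (<ℝ-ℝ≤⇒< r c/[n+1]<r r≤1/[k+1])) ,
  subst₂ _<_ (+-identityʳ (suc n)) (*-comm (suc c) (suc (suc k)))
    (/-<⇒*-< 1 (suc k) (suc c) n (<ℝ-ℝ≤⇒< r 1/[k+2]<r r≤[c+1]/[n+1]))

corollary3p2 : (r : ℝ) → frac (+ 0) 1 <ℝ r → r ℝ≤ frac (+ 1) 1 →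
    InvNotInteger r → (k : ℕ) → IsFloorInv r k →
    Σ ℕ λ N → ∀ n → N ≤ n → ∀ c → IsCeilMul r n c →
      ∀ q a b → IsQ n c q → IsOmegaNK (k * ((suc k * c) ∸ n)) k a →
        IsOmegaNK (suc k * (n ∸ k * c)) (suc k) b → q ≤ a + b
corollary3p2 r 0<r r≤1 _ zero    1<r = contradiction 1<r r≤1
corollary3p2 r 0<r r≤1 _ (suc k) ⌊1/r⌋ = 1 , λ where
  (suc n) _ zero    ⌈r[n+1]⌉         → contradiction ⌈r[n+1]⌉ (¬IsCeilMul-zero r n 0<r)
  (suc n) _ (suc c) ⌈r[n+1]⌉ q a b Q → let lower , upper = IsCeilMul-bounds r k n c ⌊1/r⌋ ⌈r[n+1]⌉ in
                                        Q≤ω+ω lower upper Q
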